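{- Let $N$ be a homogeneous network with asymmetric inputs and $\tilde{N}$ its fundamental network. Then $\tilde{N}$ is a lift of $N$ if and only if $N$ is backward connected.
   Context: A homogeneous network with asymmetric inputs has a finite cell set $C$, one cell type, $k$ edge types, each cell receiving exactly one edge of each type; it is represented by $\sigma_1,\dots,\sigma_k:C\to C$ (type-$i$ edge into $c$ comes from $\sigma_i(c)$). $L$ is a lift of $N$ if $N$ is a quotient network of $L$, i.e. $N$ is (isomorphic to) the network obtained from $L$ by a balanced coloring; equivalently there is a surjective network fibration $L\to N$ (for asymmetric inputs: a surjective cell map $\varphi$ with $\varphi\circ\sigma^L_i=\sigma_i\circ\varphi$ for all $i$). $N$ is backward connected for a cell $c$ if every cell $c'\neq c$ has a directed path (sequence of edges) to $c$; $N$ is backward connected if it is backward connected for some cell. The fundamental network $\tilde{N}$ has as cells the semigroup $\tilde{C}$ of maps $C\to C$ generated under composition by $Id_C,\sigma_1,\dots,\sigma_k$, represented by $\tilde{\sigma}_i(\gamma)=\sigma_i\circ\gamma$. -}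

module Defs where

open import Level using (Level; _⊔_; suc)
open import Data.Nat using (ℕ)
open import Data.Fin using (Fin)
open import Data.List using (List; []; _∷_; foldr)
open import Data.Product using (Σ; ∃; _×_)
open import Function using (_∘_; id)
open import Relation.Binary.PropositionalEquality using (_≡_; _≗_)
open import Relation.Binary.Structures using (IsEquivalence)
open import Relation.Nullary using (¬_)

-- A homogeneous network with asymmetric inputs on the finite cell set Fin n
-- with k edge types: σ i c is the source of the type-i edge into c.
record ANet (n k : ℕ) : Set where
  constructor anet
  field
    σ : Fin k → Fin n → Fin n

record SNet (k : ℕ) (c ℓ : Level) : Set (Level.suc (c ⊔ ℓ)) where
  field
    Cell     : Set c
    _≈_      : Cell → Cell → Set ℓ
    isEquiv  : IsEquivalence _≈_
    σ        : Fin k → Cell → Cell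
    σ-cong   : ∀ i {x y} → x ≈ y → σ i x ≈ σ i y

toSNet : ∀ {n k} → ANet n k → SNet k Level.zero Level.zero
toSNet {n} (anet s) = record
  { Cell = Fin n ; _≈_ = _≡_
  ; isEquiv = record { refl = Relation.Binary.PropositionalEquality.refl
                     ; sym = Relation.Binary.PropositionalEquality.sym
                     ; trans = Relation.Binary.PropositionalEquality.trans }
  ; σ = s ; σ-cong = λ i → Relation.Binary.PropositionalEquality.cong (s i) }

record Fibration {k c₁ ℓ₁ c₂ ℓ₂} (L : SNet k c₁ ℓ₁) (N : SNet k c₂ ℓ₂)
       : Set (c₁ ⊔ ℓ₁ ⊔ c₂ ⊔ ℓ₂) where
  private
    module L = SNet L
    module N = SNet N
  field
    φ       : L.Cell → N.Cell
    φ-cong  : ∀ {x y} → x L.≈ y → φ x N.≈ φ y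
    φ-σ     : ∀ i x → φ (L.σ i x) N.≈ N.σ i (φ x)

record SurjFibration {k c₁ ℓ₁ c₂ ℓ₂} (L : SNet k c₁ ℓ₁) (N : SNet k c₂ ℓ₂)
       : Set (c₁ ⊔ ℓ₁ ⊔ c₂ ⊔ ℓ₂) where
  field
    fib  : Fibration L N
  open Fibration fib public
  field
    surj : ∀ (y : SNet.Cell N) → Σ (SNet.Cell L) λ x → SNet._≈_ N (φ x) y

-- L is a lift of N  iff  there is a surjective network fibration L → N
-- (equivalently N is a quotient of L by a balanced coloring).
IsLift : ∀ {k c₁ ℓ₁ c₂ ℓ₂} → SNet k c₁ ℓ₁ → SNet k c₂ ℓ₂ → Set (c₁ ⊔ ℓ₁ ⊔ c₂ ⊔ ℓ₂)
IsLift L N = SurjFibration L N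

-- An element of the semigroup generated by Id, σ_1..σ_k
-- is a composite σ_{i₁} ∘ ... ∘ σ_{iₘ} (m ≥ 0, m = 0 giving Id); we represent
-- it by the word [i₁,…,iₘ], two words being equal iff the maps are equal.
evalWord : ∀ {n k} → ANet n k → List (Fin k) → (Fin n → Fin n)
evalWord (anet s) = foldr (λ i f → s i ∘ f) id

fundamental : ∀ {n k} → ANet n k → SNet k Level.zero Level.zero
fundamental {n} {k} N = record
  { Cell = List (Fin k)
  ; _≈_ = λ u v → evalWord N u ≗ evalWord N v
  ; isEquiv = record
      { refl = λ _ → Relation.Binary.PropositionalEquality.refl
      ; sym = λ p x → Relation.Binary.PropositionalEquality.sym (p x)
      ; trans = λ p q x → Relation.Binary.PropositionalEquality.trans (p x) (q x) }
  ; σ = λ i w → i ∷ w      -- σ̃_i(γ) = σ_i ∘ γ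
  ; σ-cong = λ i p x → Relation.Binary.PropositionalEquality.cong (ANet.σ N i) (p x) }

-- Directed path (sequence of edges) from a to b.  The type-i edge into d
-- goes from σ i d to d.
data Path {n k} (N : ANet n k) : Fin n → Fin n → Set where
  stop : ∀ {b} → Path N b b
  step : ∀ i {a b} → Path N a b → Path N (ANet.σ N i a) b

BackwardConnectedFor : ∀ {n k} → ANet n k → Fin n → Set
BackwardConnectedFor N c = ∀ c′ → ¬ (c′ ≡ c) → Path N c′ c

BackwardConnected : ∀ {n k} → ANet n k → Set
BackwardConnected {n} N = Σ (Fin n) λ c → BackwardConnectedFor N c

module Submission where

open import Defs
open import Data.Nat using (ℕ)
open import Data.Fin using (Fin; _≟_)
open import Data.List using (List; []; _∷_)
open import Data.Product using (∃; _,_)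
open import Function.Bundles using (_⇔_; mk⇔)
open import Relation.Nullary using (yes; no)
open import Relation.Binary.PropositionalEquality

-- A cell c of N generates the cells reached by the maps γ of the fundamental
-- semigroup applied to c; backward connectivity for c says this orbit is all
-- of C, and the fibrations from the fundamental network are exactly the
-- evaluations γ ↦ γ c.  So a surjective fibration is the same as a cell
-- whose orbit is everything.

private
  variable
    n k : ℕ

Orbit : ANet n k → Fin n → Fin n → Set
Orbit N c a = ∃ λ w → evalWord N w c ≡ a

path-from-orbit : (N : ANet n k) (c : Fin n) (w : List (Fin k)) →
                  Path N (evalWord N w c) c
path-from-orbit N c []      = stop
path-from-orbit N c (i ∷ w) = step i (path-from-orbit N c w)

orbit-from-path : (N : ANet n k) {a c : Fin n} → Path N a c → Orbit N c a
orbit-from-path N stop = [] , refl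
orbit-from-path N (step i p) with orbit-from-path N p
... | w , evalw≡a = i ∷ w , cong (ANet.σ N i) evalw≡a

backwardConnectedFor⇒orbit-total : (N : ANet n k) {c : Fin n} →
  BackwardConnectedFor N c → ∀ a → Orbit N c a
backwardConnectedFor⇒orbit-total N {c} bc a with a ≟ c
... | yes a≡c = [] , sym a≡c
... | no  a≢c = orbit-from-path N (bc a a≢c)

orbit-total⇒backwardConnectedFor : (N : ANet n k) {c : Fin n} →
  (∀ a → Orbit N c a) → BackwardConnectedFor N c
orbit-total⇒backwardConnectedFor N {c} total a _ with total a
... | w , refl = path-from-orbit N c w

evaluationFibration : (N : ANet n k) → Fin n → Fibration (fundamental N) (toSNet N)
evaluationFibration N c = record
  { φ      = λ w → evalWord N w c
  ; φ-cong = λ w≈v → w≈v c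
  ; φ-σ    = λ _ _ → refl
  }

fibration-is-evaluation : (N : ANet n k) (F : Fibration (fundamental N) (toSNet N)) →
  ∀ w → Fibration.φ F w ≡ evalWord N w (Fibration.φ F [])
fibration-is-evaluation N F []      = refl
fibration-is-evaluation N F (i ∷ w) =
  trans (φ-σ i w) (cong (ANet.σ N i) (fibration-is-evaluation N F w))
  where open Fibration F

mainTheorem6 : ∀ {n k : ℕ} (N : ANet n k) →
    IsLift (fundamental N) (toSNet N) ⇔ BackwardConnected N
mainTheorem6 N = mk⇔ lift⇒connected connected⇒lift
  where
  lift⇒connected : IsLift (fundamental N) (toSNet N) → BackwardConnected N
  lift⇒connected F = φ [] , orbit-total⇒backwardConnectedFor N orbit-total
    where
    open SurjFibration F
    orbit-total : ∀ a → Orbit N (φ []) a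
    orbit-total a with surj a
    ... | w , φw≡a = w , trans (sym (fibration-is-evaluation N fib w)) φw≡a

  connected⇒lift : BackwardConnected N → IsLift (fundamental N) (toSNet N)
  connected⇒lift (c , bc) = record
    { fib  = evaluationFibration N c
    ; surj = backwardConnectedFor⇒orbit-total N bc
    }
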